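{- A graph $G$ is neighborhood-prime if either of the following holds: (a) $G$ is a bivalent-free tree; or (b) $G$ is a tree such that there is a path between two leaves of $G$ containing all vertices of $G$ of degree $2$.
   Context: A neighborhood-prime labeling of a simple graph $G$ with $N$ vertices is a bijection $f:V(G)\to\{1,\ldots,N\}$ such that for every vertex $v$ with $\deg(v)>1$, $\gcd\{f(u):u\in N(v)\}=1$, where $N(v)$ is the neighborhood of $v$; a graph admitting one is neighborhood-prime. A bivalent-free tree is a tree in which every non-leaf vertex has degree at least $3$, i.e., no vertex has degree $2$. -}

module Defs where

open import Data.Nat using (ℕ; suc; _≥_; _>_)
open import Data.Nat.GCD using (gcd)
open import Data.Fin using (Fin; toℕ)
open import Data.Bool using (Bool; true; false)
open import Data.List using (List; length; map; foldr; filterᵇ; allFin; head; last)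
open import Data.List.Relation.Unary.Unique.Propositional using (Unique)
open import Data.List.Relation.Unary.Linked using (Linked)
open import Data.List.Membership.Propositional using (_∈_)
open import Data.Maybe using (Maybe; just)
open import Data.Product using (_×_; Σ; ∃; ∃-syntax)
open import Function.Bundles using (_⤖_; Bijection)
open import Relation.Binary.PropositionalEquality using (_≡_; _≢_)
open import Relation.Nullary using (¬_)

record Graph (n : ℕ) : Set where
  field
    adj    : Fin n → Fin n → Bool
    sym    : ∀ u v → adj u v ≡ adj v u
    irrefl : ∀ v → adj v v ≡ false

module _ {n : ℕ} (G : Graph n) where
  open Graph G

  Adj : Fin n → Fin n → Set
  Adj u v = adj u v ≡ true

  nbrs : Fin n → List (Fin n)
  nbrs v = filterᵇ (adj v) (allFin n)

  deg : Fin n → ℕ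
  deg v = length (nbrs v)

  IsPath : Fin n → Fin n → List (Fin n) → Set
  IsPath u v p = Unique p × Linked Adj p × head p ≡ just u × last p ≡ just v

  Connected : Set
  Connected = ∀ u v → ∃[ p ] IsPath u v p

  IsCycle : List (Fin n) → Set
  IsCycle p = Unique p × Linked Adj p × length p ≥ 3
              × ∃[ a ] ∃[ b ] (head p ≡ just a × last p ≡ just b × Adj b a)

  Acyclic : Set
  Acyclic = ∀ p → ¬ IsCycle p

  IsTree : Set
  IsTree = Connected × Acyclic

  IsLeaf : Fin n → Set
  IsLeaf v = deg v ≡ 1

  IsBivalentFreeTree : Set
  IsBivalentFreeTree = IsTree × (∀ v → deg v ≢ 2)

gcdList : List ℕ → ℕ
gcdList = foldr gcd 0

-- neighborhood-prime labeling: bijection f : V → {1..N}, encoded as a bijection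
-- σ : Fin n ⤖ Fin n with label v = toℕ (σ v) + 1.
IsNeighborhoodPrimeLabeling : {n : ℕ} (G : Graph n) → (Fin n ⤖ Fin n) → Set
IsNeighborhoodPrimeLabeling {n} G σ =
  ∀ v → deg G v > 1 → gcdList (map (λ u → suc (toℕ (Bijection.to σ u))) (nbrs G v)) ≡ 1

NeighborhoodPrime : {n : ℕ} → Graph n → Set
NeighborhoodPrime {n} G = ∃[ σ ] IsNeighborhoodPrimeLabeling G σ

-- Root the tree at one end a of a spine path (the given leaf-to-leaf path, or the single vertex a in the
-- bivalent-free case) and list the vertices as: the spine vertices at even positions, those at odd
-- positions, then the remaining vertices grouped by their parent. Labelling each vertex by its place in
-- this list, an interior spine vertex sees its two spine neighbours with consecutive labels. Any other
-- vertex of degree > 1 has degree ≥ 3 and no child on the spine, so it has two children off the spine,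
-- the first two of its group, again with consecutive labels. Consecutive labels are coprime.

module Submission where

open import Defs
open import Data.Bool using (T; true)
open import Data.Empty using (⊥-elim)
open import Function.Bundles using (_⤖_; Bijection; mk⤖)
open import Function.Construct.Identity using (⤖-id)
open import Data.Fin using (Fin; zero; suc; toℕ; cast; _≟_)
open import Data.Fin.Properties using (toℕ-cast; toℕ-injective; cast-involutive; cantor-schröder-bernstein)
open import Data.List using (List; []; _∷_; _++_; [_]; _ʳ++_; length; head; last; lookup; map; filter; concatMap; allFin)
open import Data.List.Properties using (++-assoc; length-ʳ++; length-++)
open import Data.List.Membership.Propositional using (_∈_; _∉_; find; lose)
open import Data.List.Membership.Propositional.Properties using (∈-++⁺ˡ; ∈-++⁺ʳ; ∈-++⁻; ∈-∃++; ∈-filter⁺; ∈-filter⁻; ∈-allFin; ∈-map⁺; ∈-lookup; ∈-concatMap⁺; ∈-concatMap⁻)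
import Data.List.Membership.DecPropositional as DecMembership
open import Data.List.Relation.Binary.Disjoint.Propositional using (Disjoint)
open import Data.List.Relation.Unary.All.Properties using (¬Any⇒All¬)
open import Data.List.Relation.Unary.Any using (here; there; index)
open import Data.List.Relation.Unary.Any.Properties using (lookup-index)
open import Data.List.Relation.Unary.AllPairs using ([]; _∷_)
open import Data.List.Relation.Unary.Linked using (Linked; []; [-]; _∷_)
open import Data.List.Relation.Unary.Unique.Propositional using (Unique)
open import Data.List.Relation.Unary.Unique.Propositional.Properties using (Unique[x∷xs]⇒x∉xs; filter⁺; allFin⁺; ++⁺)
open import Data.Maybe using (just)
open import Data.Nat using (ℕ; zero; suc; _+_; _≤_; _>_; _≥_; z≤n; s≤s)
open import Data.Nat.Divisibility using (_∣_; ∣-trans; ∣m+n∣m⇒∣n; ∣1⇒≡1)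
open import Data.Nat.GCD using (gcd[m,n]∣m; gcd[m,n]∣n)
open import Data.Nat.Properties using (+-comm; ≤-trans; m≤n+m; ≤∧≢⇒<; <-irrefl)
open import Data.Product using (_×_; _,_; ∃-syntax; proj₁; proj₂; uncurry)
open import Data.Sum using (_⊎_; inj₁; inj₂; [_,_]′)
open import Relation.Binary.Definitions using (Symmetric)
open import Relation.Binary.PropositionalEquality using (_≡_; _≢_; refl; sym; trans; cong; subst; module ≡-Reasoning)
open import Relation.Nullary using (¬_; Dec; yes; no)
open import Relation.Nullary.Decidable using (T?; _×-dec_; ¬?)

module _ {A : Set} where

  ∷-unique : ∀ {x : A} {xs} → x ∉ xs → Unique xs → Unique (x ∷ xs)
  ∷-unique x∉xs xs! = ¬Any⇒All¬ _ x∉xs ∷ xs!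

  unique-tail : ∀ {x : A} {xs} → Unique (x ∷ xs) → Unique xs
  unique-tail (_ ∷ xs!) = xs!

  unique-++⁻ˡ : ∀ (xs : List A) {ys} → Unique (xs ++ ys) → Unique xs
  unique-++⁻ˡ []       _ = []
  unique-++⁻ˡ (x ∷ xs) u =
    ∷-unique (λ x∈xs → Unique[x∷xs]⇒x∉xs u (∈-++⁺ˡ x∈xs)) (unique-++⁻ˡ xs (unique-tail u))

  unique-ʳ++ : ∀ (xs : List A) {ys} → Unique xs → Unique ys → Disjoint xs ys → Unique (xs ʳ++ ys)
  unique-ʳ++ []       _  ys! _       = ys!
  unique-ʳ++ (x ∷ xs) xs! ys! xs#ys =
    unique-ʳ++ xs (unique-tail xs!) (∷-unique (λ x∈ys → xs#ys (here refl , x∈ys)) ys!)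
      λ { (v∈xs , here refl) → Unique[x∷xs]⇒x∉xs xs! v∈xs ; (v∈xs , there v∈ys) → xs#ys (there v∈xs , v∈ys) }

  module _ {R : A → A → Set} where

    linked-++⁻ˡ : ∀ (xs : List A) {ys} → Linked R (xs ++ ys) → Linked R xs
    linked-++⁻ˡ []           _         = []
    linked-++⁻ˡ (x ∷ [])     _         = [-]
    linked-++⁻ˡ (x ∷ y ∷ xs) (r ∷ rs) = r ∷ linked-++⁻ˡ (y ∷ xs) rs

    linked-ʳ++ : Symmetric R → ∀ {x} xs {ys} → Linked R (x ∷ xs) → Linked R (x ∷ ys) → Linked R (xs ʳ++ x ∷ ys)
    linked-ʳ++ R-sym []       _        rys = rys
    linked-ʳ++ R-sym (y ∷ xs) (r ∷ rs) rys = linked-ʳ++ R-sym xs rs (R-sym r ∷ rys)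

    linked-middle : ∀ B {x v y : A} C → Linked R (B ++ x ∷ v ∷ y ∷ C) → R x v × R v y
    linked-middle []           C (r ∷ r′ ∷ _) = r , r′
    linked-middle (_ ∷ [])     C (_ ∷ rs)     = linked-middle [] C rs
    linked-middle (_ ∷ b ∷ B) C (_ ∷ rs)     = linked-middle (b ∷ B) C rs

    linked-last : ∀ (x : A) xs {y} ys → Linked R (x ∷ xs ++ y ∷ ys) → ∃[ z ] (last (x ∷ xs) ≡ just z × R z y)
    linked-last x []       ys (r ∷ _)  = x , refl , r
    linked-last x (x′ ∷ xs) ys (_ ∷ rs) = linked-last x′ xs ys rs

  head-ʳ++ : ∀ (x : A) xs ys → head (xs ʳ++ x ∷ ys) ≡ last (x ∷ xs)
  head-ʳ++ x []       ys = refl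
  head-ʳ++ x (y ∷ xs) ys = head-ʳ++ y xs (x ∷ ys)

  last-ʳ++ : ∀ (x : A) xs ys → last (xs ʳ++ x ∷ ys) ≡ last (x ∷ ys)
  last-ʳ++ x []       ys = refl
  last-ʳ++ x (y ∷ xs) ys = last-ʳ++ y xs (x ∷ ys)

  last-∷ʳ : ∀ (xs : List A) x → last (xs ++ [ x ]) ≡ just x
  last-∷ʳ []           x = refl
  last-∷ʳ (_ ∷ [])     x = refl
  last-∷ʳ (_ ∷ y ∷ xs) x = last-∷ʳ (y ∷ xs) x

  ∈-last : ∀ {v : A} xs → last xs ≡ just v → v ∈ xs
  ∈-last (x ∷ [])     refl = here refl
  ∈-last (x ∷ y ∷ xs) eq   = there (∈-last (y ∷ xs) eq)

  firstShared : (∀ (v : A) ys → Dec (v ∈ ys)) → ∀ xs ys {z} → z ∈ xs → z ∈ ys →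
    ∃[ B ] ∃[ w ] ∃[ C ] (xs ≡ B ++ w ∷ C × (∀ {v} → v ∈ B → v ∉ ys) × w ∈ ys)
  firstShared _∈?_ (x ∷ xs) ys z∈xs z∈ys with x ∈? ys
  ... | yes x∈ys = [] , x , xs , refl , (λ ()) , x∈ys
  firstShared _∈?_ (x ∷ xs) ys (here refl)  z∈ys | no x∉ys = ⊥-elim (x∉ys z∈ys)
  firstShared _∈?_ (x ∷ xs) ys (there z∈xs) z∈ys | no x∉ys
    with firstShared _∈?_ xs ys z∈xs z∈ys
  ... | B , w , C , refl , B#ys , w∈ys =
    x ∷ B , w , C , refl , (λ { (here refl) → x∉ys ; (there v∈B) → B#ys v∈B }) , w∈ys

  Consecutive : A → A → List A → Set
  Consecutive x y xs = ∃[ B ] ∃[ C ] (xs ≡ B ++ x ∷ y ∷ C)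

  consecutive-++ˡ : ∀ {x y} xs ys → Consecutive x y xs → Consecutive x y (xs ++ ys)
  consecutive-++ˡ _ ys (B , C , refl) = B , C ++ ys , ++-assoc B (_ ∷ _ ∷ C) ys

  consecutive-++ʳ : ∀ {x y} xs ys → Consecutive x y ys → Consecutive x y (xs ++ ys)
  consecutive-++ʳ xs _ (B , C , refl) = xs ++ B , C , sym (++-assoc xs B (_ ∷ _ ∷ C))

  Interior : A → List A → Set
  Interior v xs = ∃[ B ] ∃[ x ] ∃[ y ] ∃[ C ] (xs ≡ B ++ x ∷ v ∷ y ∷ C)

  interior-of-∈ : ∀ {v b : A} x xs → v ∈ xs → last (x ∷ xs) ≡ just b → v ≢ b → Interior v (x ∷ xs)
  interior-of-∈ x (y ∷ [])     (here refl)  refl   v≢b = ⊥-elim (v≢b refl)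
  interior-of-∈ x (y ∷ z ∷ xs) (here refl)  _      _   = [] , x , z , xs , refl
  interior-of-∈ x (y ∷ xs)     (there v∈xs) last≡b v≢b with interior-of-∈ y xs v∈xs last≡b v≢b
  ... | B , x′ , y′ , C , eq = x ∷ B , x′ , y′ , C , cong (x ∷_) eq

  mutual
    evens : List A → List A
    evens []       = []
    evens (x ∷ xs) = x ∷ odds xs

    odds : List A → List A
    odds []       = []
    odds (x ∷ xs) = evens xs

  evensThenOdds : List A → List A
  evensThenOdds xs = evens xs ++ odds xs

  mutual
    ∈-evens⁻ : ∀ {v : A} xs → v ∈ evens xs → v ∈ xs
    ∈-evens⁻ (x ∷ xs) (here refl)  = here refl
    ∈-evens⁻ (x ∷ xs) (there v∈xs) = there (∈-odds⁻ xs v∈xs)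

    ∈-odds⁻ : ∀ {v : A} xs → v ∈ odds xs → v ∈ xs
    ∈-odds⁻ (x ∷ xs) v∈xs = there (∈-evens⁻ xs v∈xs)

  ∈-evens⊎odds : ∀ {v : A} xs → v ∈ xs → v ∈ evens xs ⊎ v ∈ odds xs
  ∈-evens⊎odds (x ∷ xs) (here refl) = inj₁ (here refl)
  ∈-evens⊎odds (x ∷ xs) (there v∈xs) with ∈-evens⊎odds xs v∈xs
  ... | inj₁ v∈evens = inj₂ v∈evens
  ... | inj₂ v∈odds  = inj₁ (there v∈odds)

  mutual
    evens-unique : ∀ xs → Unique xs → Unique (evens xs)
    evens-unique []       _   = []
    evens-unique (x ∷ xs) xs! = ∷-unique (λ x∈ → Unique[x∷xs]⇒x∉xs xs! (∈-odds⁻ xs x∈)) (odds-unique xs (unique-tail xs!))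

    odds-unique : ∀ xs → Unique xs → Unique (odds xs)
    odds-unique []       _   = []
    odds-unique (x ∷ xs) xs! = evens-unique xs (unique-tail xs!)

  evens-odds-disjoint : ∀ xs → Unique xs → Disjoint (evens xs) (odds xs)
  evens-odds-disjoint (x ∷ xs) xs! (here refl  , v∈odds) = Unique[x∷xs]⇒x∉xs xs! (∈-evens⁻ xs v∈odds)
  evens-odds-disjoint (x ∷ xs) xs! (there v∈odds , v∈evens) = evens-odds-disjoint xs (unique-tail xs!) (v∈evens , v∈odds)

  evensThenOdds-unique : ∀ xs → Unique xs → Unique (evensThenOdds xs)
  evensThenOdds-unique xs xs! = ++⁺ (evens-unique xs xs!) (odds-unique xs xs!) (evens-odds-disjoint xs xs!)

  ∈-evensThenOdds⁺ : ∀ {v : A} xs → v ∈ xs → v ∈ evensThenOdds xs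
  ∈-evensThenOdds⁺ xs v∈xs with ∈-evens⊎odds xs v∈xs
  ... | inj₁ v∈evens = ∈-++⁺ˡ v∈evens
  ... | inj₂ v∈odds  = ∈-++⁺ʳ (evens xs) v∈odds

  ∈-evensThenOdds⁻ : ∀ {v : A} xs → v ∈ evensThenOdds xs → v ∈ xs
  ∈-evensThenOdds⁻ xs v∈ with ∈-++⁻ (evens xs) v∈
  ... | inj₁ v∈evens = ∈-evens⁻ xs v∈evens
  ... | inj₂ v∈odds  = ∈-odds⁻ xs v∈odds

  consecutive-evens⊎odds : ∀ B {x v y : A} C →
    Consecutive x y (evens (B ++ x ∷ v ∷ y ∷ C)) ⊎ Consecutive x y (odds (B ++ x ∷ v ∷ y ∷ C))
  consecutive-evens⊎odds []      C = inj₁ ([] , odds C , refl)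
  consecutive-evens⊎odds (b ∷ B) C with consecutive-evens⊎odds B C
  ... | inj₁ in-evens          = inj₂ in-evens
  ... | inj₂ (B′ , C′ , eq) = inj₁ (b ∷ B′ , C′ , cong (b ∷_) eq)

  consecutive-evensThenOdds : ∀ B {x v y : A} C → Consecutive x y (evensThenOdds (B ++ x ∷ v ∷ y ∷ C))
  consecutive-evensThenOdds B C with consecutive-evens⊎odds B C
  ... | inj₁ in-evens = consecutive-++ˡ _ _ in-evens
  ... | inj₂ in-odds  = consecutive-++ʳ (evens _) _ in-odds

  index-unique : ∀ {xs} B {x : A} C → xs ≡ B ++ x ∷ C → Unique xs → (x∈ : x ∈ xs) → toℕ (index x∈) ≡ length B
  index-unique []      C refl x! (here refl) = refl
  index-unique []      C refl x! (there x∈C) = ⊥-elim (Unique[x∷xs]⇒x∉xs x! x∈C)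
  index-unique (b ∷ B) C refl x! (here refl) = ⊥-elim (Unique[x∷xs]⇒x∉xs x! (∈-++⁺ʳ B (here refl)))
  index-unique (b ∷ B) C refl x! (there x∈) = cong suc (index-unique B C refl (unique-tail x!) x∈)

  three-distinct : ∀ (xs : List A) → 3 ≤ length xs → Unique xs →
    ∃[ x ] ∃[ y ] ∃[ z ] (x ∈ xs × y ∈ xs × z ∈ xs × x ≢ y × x ≢ z × y ≢ z)
  three-distinct (_ ∷ [])         (s≤s ())         _
  three-distinct (_ ∷ _ ∷ [])     (s≤s (s≤s ()))   _
  three-distinct (x ∷ y ∷ z ∷ xs) _ xs! =
    x , y , z , here refl , there (here refl) , there (there (here refl)) ,
    (λ x≡y → Unique[x∷xs]⇒x∉xs xs! (here x≡y)) , (λ x≡z → Unique[x∷xs]⇒x∉xs xs! (there (here x≡z))) ,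
    (λ y≡z → Unique[x∷xs]⇒x∉xs (unique-tail xs!) (here y≡z))

  lookup-injective : ∀ (xs : List A) → Unique xs → ∀ {i j} → lookup xs i ≡ lookup xs j → i ≡ j
  lookup-injective (x ∷ xs) xs! {zero}  {zero}  _  = refl
  lookup-injective (x ∷ xs) xs! {zero}  {suc j} eq = ⊥-elim (Unique[x∷xs]⇒x∉xs xs! (subst (_∈ xs) (sym eq) (∈-lookup j)))
  lookup-injective (x ∷ xs) xs! {suc i} {zero}  eq = ⊥-elim (Unique[x∷xs]⇒x∉xs xs! (subst (_∈ xs) eq (∈-lookup i)))
  lookup-injective (x ∷ xs) xs! {suc i} {suc j} eq = cong suc (lookup-injective xs (unique-tail xs!) eq)

  ∷∷-of-two-distinct : ∀ {w₁ w₂ : A} xs → w₁ ∈ xs → w₂ ∈ xs → w₁ ≢ w₂ → ∃[ c₁ ] ∃[ c₂ ] ∃[ r ] (xs ≡ c₁ ∷ c₂ ∷ r)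
  ∷∷-of-two-distinct (x ∷ [])     (here refl) (here refl) w₁≢w₂ = ⊥-elim (w₁≢w₂ refl)
  ∷∷-of-two-distinct (x ∷ y ∷ xs) _           _           _     = x , y , xs , refl

module _ {A B : Set} (f : A → List B) where

  unique-concatMap : ∀ {us} → Unique us → (∀ u → Unique (f u)) → (∀ {u u′ w} → w ∈ f u → w ∈ f u′ → u ≡ u′) →
    Unique (concatMap f us)
  unique-concatMap {[]}     _   _  _ = []
  unique-concatMap {u ∷ us} us! f! f-disjoint =
    ++⁺ (f! u) (unique-concatMap (unique-tail us!) f! f-disjoint) λ (w∈fu , w∈rest) →
      let u′ , u′∈us , w∈fu′ = find (∈-concatMap⁻ f w∈rest)
      in Unique[x∷xs]⇒x∉xs us! (subst (_∈ us) (sym (f-disjoint w∈fu w∈fu′)) u′∈us)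

  consecutive-concatMap : ∀ {u x y} us → u ∈ us → Consecutive x y (f u) → Consecutive x y (concatMap f us)
  consecutive-concatMap (u ∷ us) (here refl) xy = consecutive-++ˡ (f u) _ xy
  consecutive-concatMap (u ∷ us) (there u∈) xy = consecutive-++ʳ (f u) _ (consecutive-concatMap us u∈ xy)

module Fibres {n : ℕ} (f : Fin n → Fin n) {P : Fin n → Set} (P? : ∀ w → Dec (P w)) where

  fibre : Fin n → List (Fin n)
  fibre u = filter (λ w → P? w ×-dec f w ≟ u) (allFin n)

  fibres : List (Fin n)
  fibres = concatMap fibre (allFin n)

  ∈-fibre⁻ : ∀ {u w} → w ∈ fibre u → P w × f w ≡ u
  ∈-fibre⁻ {u} w∈ = proj₂ (∈-filter⁻ (λ w → P? w ×-dec f w ≟ u) {xs = allFin n} w∈)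

  ∈-fibre⁺ : ∀ {u w} → P w → f w ≡ u → w ∈ fibre u
  ∈-fibre⁺ {u} {w} pw fw≡u = ∈-filter⁺ (λ w → P? w ×-dec f w ≟ u) (∈-allFin w) (pw , fw≡u)

  fibres-unique : Unique fibres
  fibres-unique = unique-concatMap fibre (allFin⁺ n)
    (λ u → filter⁺ (λ w → P? w ×-dec f w ≟ u) (allFin⁺ n))
    (λ w∈ w∈′ → trans (sym (proj₂ (∈-fibre⁻ w∈))) (proj₂ (∈-fibre⁻ w∈′)))

  ∈-fibres⁺ : ∀ {w} → P w → w ∈ fibres
  ∈-fibres⁺ {w} pw = ∈-concatMap⁺ fibre (lose (∈-allFin (f w)) (∈-fibre⁺ pw refl))

  ∈-fibres⁻ : ∀ {w} → w ∈ fibres → P w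
  ∈-fibres⁻ w∈ = let _ , _ , w∈fibre = find (∈-concatMap⁻ fibre {xs = allFin n} w∈) in proj₁ (∈-fibre⁻ w∈fibre)

  consecutive-fibres : ∀ {u w₁ w₂} → w₁ ≢ w₂ → P w₁ → f w₁ ≡ u → P w₂ → f w₂ ≡ u →
    ∃[ c₁ ] ∃[ c₂ ] (Consecutive c₁ c₂ fibres × f c₁ ≡ u × f c₂ ≡ u × P c₁ × P c₂)
  consecutive-fibres {u} w₁≢w₂ pw₁ fw₁ pw₂ fw₂
    with ∷∷-of-two-distinct (fibre u) (∈-fibre⁺ pw₁ fw₁) (∈-fibre⁺ pw₂ fw₂) w₁≢w₂
  ... | c₁ , c₂ , r , eq =
    c₁ , c₂ , consecutive-concatMap fibre (allFin n) (∈-allFin u) ([] , r , eq) ,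
    proj₂ (∈-fibre⁻ c₁∈) , proj₂ (∈-fibre⁻ c₂∈) , proj₁ (∈-fibre⁻ c₁∈) , proj₁ (∈-fibre⁻ c₂∈)
    where
    c₁∈ : c₁ ∈ fibre u
    c₁∈ = subst (c₁ ∈_) (sym eq) (here refl)
    c₂∈ : c₂ ∈ fibre u
    c₂∈ = subst (c₂ ∈_) (sym eq) (there (here refl))

module _ {n : ℕ} (G : Graph n) where
  open DecMembership (_≟_ {n}) using (_∈?_)

  Adj-sym : Symmetric (Adj G)
  Adj-sym {u} {v} uv = trans (Graph.sym G v u) uv

  Adj-irrefl : ∀ {u} → ¬ Adj G u u
  Adj-irrefl {u} uu with trans (sym uu) (Graph.irrefl G u)
  ... | ()

  edge-unique : ∀ {u w} → Adj G u w → Unique (u ∷ w ∷ [])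
  edge-unique uw = ∷-unique (λ { (here refl) → Adj-irrefl uw }) (∷-unique (λ ()) [])

  private
    cycle-length : ∀ (A B : List (Fin n)) w → ¬ (A ≡ [] × B ≡ []) → 3 ≤ length A + suc (length (B ++ [ w ]))
    cycle-length []      []      w A∨B = ⊥-elim (A∨B (refl , refl))
    cycle-length []      (_ ∷ B) w _   rewrite length-++ B {[ w ]} | +-comm (length B) 1 = s≤s (s≤s (s≤s z≤n))
    cycle-length (_ ∷ A) B       w _   rewrite length-++ B {[ w ]} | +-comm (length B) 1 =
      s≤s (≤-trans (s≤s (s≤s z≤n)) (m≤n+m (suc (suc (length B))) (length A)))

  -- Walking back along r₁ from its first vertex shared with r₂, then out along r₂, closes a cycle through x.
  meeting-paths⇒cycle : ∀ x r₁ r₂ {z} → head r₁ ≢ head r₂ →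
    Unique (x ∷ r₁) → Linked (Adj G) (x ∷ r₁) → Unique (x ∷ r₂) → Linked (Adj G) (x ∷ r₂) →
    z ∈ r₁ → z ∈ r₂ → ∃[ c ] IsCycle G c
  meeting-paths⇒cycle x r₁ r₂ heads≢ r₁! r₁-path r₂! r₂-path z∈r₁ z∈r₂
    with firstShared _∈?_ r₁ r₂ z∈r₁ z∈r₂
  ... | A , w , C , refl , A#r₂ , w∈r₂ with ∈-∃++ w∈r₂
  ... | B , D , refl with linked-last x A C r₁-path
  ... | h , last≡h , wh =
    A ʳ++ x ∷ B ++ [ w ] , cycle! , cycle-path , cycle-long , h , w ,
    trans (head-ʳ++ x A _) last≡h , trans (last-ʳ++ x A _) (last-∷ʳ (x ∷ B) w) , Adj-sym wh
    where
    r₂≡ : x ∷ B ++ w ∷ D ≡ (x ∷ B ++ [ w ]) ++ D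
    r₂≡ = cong (x ∷_) (sym (++-assoc B [ w ] D))
    xBw! : Unique (x ∷ B ++ [ w ])
    xBw! = unique-++⁻ˡ (x ∷ B ++ [ w ]) (subst Unique r₂≡ r₂!)
    cycle! : Unique (A ʳ++ x ∷ B ++ [ w ])
    cycle! = unique-ʳ++ A (unique-++⁻ˡ A (unique-tail r₁!)) xBw! λ where
      (v∈A , here refl)   → Unique[x∷xs]⇒x∉xs r₁! (∈-++⁺ˡ v∈A)
      (v∈A , there v∈Bw) → A#r₂ v∈A (subst (_ ∈_) (++-assoc B [ w ] D) (∈-++⁺ˡ v∈Bw))
    cycle-path : Linked (Adj G) (A ʳ++ x ∷ B ++ [ w ])
    cycle-path = linked-ʳ++ Adj-sym A (linked-++⁻ˡ (x ∷ A) r₁-path)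
                   (linked-++⁻ˡ (x ∷ B ++ [ w ]) (subst (Linked (Adj G)) r₂≡ r₂-path))
    cycle-long : length (A ʳ++ x ∷ B ++ [ w ]) ≥ 3
    cycle-long rewrite length-ʳ++ A {x ∷ B ++ [ w ]} = cycle-length A B w λ { (refl , refl) → heads≢ refl }

  Acyclic⇒second-vertex-unique : Acyclic G → ∀ {x y₁ y₂ z} r₁ r₂ →
    Unique (x ∷ y₁ ∷ r₁) → Linked (Adj G) (x ∷ y₁ ∷ r₁) →
    Unique (x ∷ y₂ ∷ r₂) → Linked (Adj G) (x ∷ y₂ ∷ r₂) →
    z ∈ y₁ ∷ r₁ → z ∈ y₂ ∷ r₂ → y₁ ≡ y₂
  Acyclic⇒second-vertex-unique acyclic {x} {y₁} {y₂} r₁ r₂ r₁! r₁-path r₂! r₂-path z∈r₁ z∈r₂ with y₁ ≟ y₂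
  ... | yes y₁≡y₂ = y₁≡y₂
  ... | no y₁≢y₂ with meeting-paths⇒cycle x (y₁ ∷ r₁) (y₂ ∷ r₂) (λ { refl → y₁≢y₂ refl })
                        r₁! r₁-path r₂! r₂-path z∈r₁ z∈r₂
  ...   | c , c-cycle = ⊥-elim (acyclic c c-cycle)

  ∈-nbrs⁺ : ∀ {v w} → Adj G v w → w ∈ nbrs G v
  ∈-nbrs⁺ {v} {w} vw = ∈-filter⁺ (λ u → T? (Graph.adj G v u)) (∈-allFin w) (subst T (sym vw) _)

  ∈-nbrs⁻ : ∀ {v w} → w ∈ nbrs G v → Adj G v w
  ∈-nbrs⁻ {v} {w} w∈ with Graph.adj G v w | proj₂ (∈-filter⁻ (λ u → T? (Graph.adj G v u)) {xs = allFin n} w∈)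
  ... | true | _ = refl

  nbrs-unique : ∀ v → Unique (nbrs G v)
  nbrs-unique v = filter⁺ (λ u → T? (Graph.adj G v u)) (allFin⁺ n)

gcdList-divides : ∀ {x} xs → x ∈ xs → gcdList xs ∣ x
gcdList-divides (y ∷ ys) (here refl) = gcd[m,n]∣m y (gcdList ys)
gcdList-divides (y ∷ ys) (there x∈) = ∣-trans (gcd[m,n]∣n y (gcdList ys)) (gcdList-divides ys x∈)

gcdList-consecutive : ∀ {k} xs → k ∈ xs → suc k ∈ xs → gcdList xs ≡ 1
gcdList-consecutive {k} xs k∈ 1+k∈ =
  ∣1⇒≡1 (∣m+n∣m⇒∣n (subst (gcdList xs ∣_) (+-comm 1 k) (gcdList-divides xs 1+k∈)) (gcdList-divides xs k∈))

module Enumeration {n : ℕ} (L : List (Fin n)) (L! : Unique L) (complete : ∀ v → v ∈ L) where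
  open ≡-Reasoning

  position : Fin n → Fin (length L)
  position v = index (complete v)

  position-injective : ∀ {v w} → position v ≡ position w → v ≡ w
  position-injective {v} {w} eq = begin
    v                        ≡⟨ lookup-index (complete v) ⟩
    lookup L (position v)    ≡⟨ cong (lookup L) eq ⟩
    lookup L (position w)    ≡⟨ lookup-index (complete w) ⟨
    w                        ∎

  length≡ : length L ≡ n
  length≡ = cantor-schröder-bernstein (lookup-injective L L!) position-injective

  rank : Fin n ⤖ Fin n
  rank = mk⤖ {to = λ v → cast length≡ (position v)} (injective , surjective)
    where
    injective : ∀ {v w} → cast length≡ (position v) ≡ cast length≡ (position w) → v ≡ w
    injective {v} {w} eq = position-injective (toℕ-injective (begin
      toℕ (position v)                 ≡⟨ toℕ-cast length≡ (position v) ⟨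
      toℕ (cast length≡ (position v))  ≡⟨ cong toℕ eq ⟩
      toℕ (cast length≡ (position w))  ≡⟨ toℕ-cast length≡ (position w) ⟩
      toℕ (position w)                 ∎))
    surjective : ∀ i → ∃[ v ] (∀ {w} → w ≡ v → cast length≡ (position w) ≡ i)
    surjective i = lookup L j , λ { refl → trans (cong (cast length≡) position-lookup) (cast-involutive length≡ (sym length≡) i) }
      where
      j : Fin (length L)
      j = cast (sym length≡) i
      position-lookup : position (lookup L j) ≡ j
      position-lookup = lookup-injective L L! (sym (lookup-index (complete (lookup L j))))

  rank-consecutive : ∀ B {x y} C → L ≡ B ++ x ∷ y ∷ C → toℕ (Bijection.to rank y) ≡ suc (toℕ (Bijection.to rank x))
  rank-consecutive B {x} {y} C eq = begin
    toℕ (cast length≡ (position y))  ≡⟨ toℕ-cast length≡ (position y) ⟩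
    toℕ (position y)                 ≡⟨ index-unique (B ++ [ x ]) C (trans eq (sym (++-assoc B [ x ] (y ∷ C)))) L! (complete y) ⟩
    length (B ++ [ x ])              ≡⟨ trans (length-++ B) (+-comm (length B) 1) ⟩
    suc (length B)                   ≡⟨ cong suc (index-unique B (y ∷ C) eq L! (complete x)) ⟨
    suc (toℕ (position x))           ≡⟨ cong suc (toℕ-cast length≡ (position x)) ⟨
    suc (toℕ (cast length≡ (position x))) ∎

  neighbourhoodPrime : ∀ (G : Graph n) →
    (∀ v → deg G v > 1 → ∃[ x ] ∃[ y ] (Adj G v x × Adj G v y × Consecutive x y L)) → NeighborhoodPrime G
  neighbourhoodPrime G consecutive-nbrs = rank , coprime
    where
    label : Fin n → ℕ
    label u = suc (toℕ (Bijection.to rank u))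
    coprime : IsNeighborhoodPrimeLabeling G rank
    coprime v deg>1 with consecutive-nbrs v deg>1
    ... | x , y , vx , vy , B , C , eq =
      gcdList-consecutive (map label (nbrs G v)) (∈-map⁺ label (∈-nbrs⁺ G vx))
        (subst (_∈ map label (nbrs G v)) (cong suc (rank-consecutive B C eq)) (∈-map⁺ label (∈-nbrs⁺ G vy)))

module RootedTree {n : ℕ} (G : Graph n) (tree : IsTree G) (root : Fin n) where
  open DecMembership (_≟_ {n}) using (_∈?_)

  ReachesRootVia : Fin n → Fin n → Set
  ReachesRootVia v s = ∃[ t ] (Unique (v ∷ s ∷ t) × Linked (Adj G) (v ∷ s ∷ t) × root ∈ s ∷ t)

  private
    pathToRoot : Fin n → List (Fin n)
    pathToRoot v = proj₁ (proj₁ tree v root)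

    second : List (Fin n) → Fin n
    second (_ ∷ s ∷ _) = s
    second _           = root

  parent : Fin n → Fin n
  parent v = second (pathToRoot v)

  parent-root : parent root ≡ root
  parent-root = second-of-loop (pathToRoot root) (proj₂ (proj₁ tree root root))
    where
    second-of-loop : ∀ p → IsPath G root root p → second p ≡ root
    second-of-loop []          _                     = refl
    second-of-loop (_ ∷ [])    _                     = refl
    second-of-loop (_ ∷ s ∷ t) (p! , _ , refl , p-last) = ⊥-elim (Unique[x∷xs]⇒x∉xs p! (∈-last (s ∷ t) p-last))

  reachesRootVia-parent : ∀ {v} → v ≢ root → ReachesRootVia v (parent v)
  reachesRootVia-parent {v} v≢root = second-of-path (pathToRoot v) (proj₂ (proj₁ tree v root))
    where
    second-of-path : ∀ p → IsPath G v root p → ReachesRootVia v (second p)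
    second-of-path []          (_ , _ , () , _)
    second-of-path (_ ∷ [])    (_ , _ , refl , refl)         = ⊥-elim (v≢root refl)
    second-of-path (_ ∷ s ∷ t) (p! , p-path , refl , p-last) = t , p! , p-path , ∈-last (s ∷ t) p-last

  reachesRootVia⇒≢root : ∀ {v s} → ReachesRootVia v s → v ≢ root
  reachesRootVia⇒≢root (_ , v! , _ , root∈) refl = Unique[x∷xs]⇒x∉xs v! root∈

  parent-unique : ∀ {v s} → ReachesRootVia v s → parent v ≡ s
  parent-unique via@(t , v! , v-path , root∈) with reachesRootVia-parent (reachesRootVia⇒≢root via)
  ... | t′ , v!′ , v-path′ , root∈′ =
    Acyclic⇒second-vertex-unique G (proj₂ tree) t′ t v!′ v-path′ v! v-path root∈′ root∈

  parent-adjacent : ∀ {v} → v ≢ root → Adj G v (parent v)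
  parent-adjacent v≢root with reachesRootVia-parent v≢root
  ... | _ , _ , v-parent ∷ _ , _ = v-parent

  parent-of-neighbour : ∀ {u w} → Adj G u w → parent w ≢ u → parent u ≡ w
  parent-of-neighbour {u} {w} uw pw≢u with w ≟ root
  ... | yes refl = parent-unique ([] , edge-unique G uw , uw ∷ [-] , here refl)
  ... | no w≢root with reachesRootVia-parent w≢root
  ... | t , w! , w-path , root∈ with u ∈? (parent w ∷ t)
  ...   | yes u∈ = ⊥-elim (pw≢u (sym (Acyclic⇒second-vertex-unique G (proj₂ tree) [] t
                      (edge-unique G (Adj-sym G uw)) (Adj-sym G uw ∷ [-])
                      w! w-path (here refl) u∈)))
  ...   | no u∉ = parent-unique (parent w ∷ t ,
                    ∷-unique (λ { (here refl) → Adj-irrefl G uw ; (there u∈) → u∉ u∈ }) w! ,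
                    uw ∷ w-path , there root∈)

  parents-along : ∀ x l → Unique (x ∷ l) → Linked (Adj G) (x ∷ l) → parent x ∉ l →
    ∀ {w} → w ∈ l → parent w ∈ x ∷ l
  parents-along x (y ∷ l) xl! (xy ∷ yl-path) px∉ = λ where
      (here refl)  → here parent-y
      (there w∈l) → there (parents-along y l (unique-tail xl!) yl-path py∉l w∈l)
    where
    parent-y : parent y ≡ x
    parent-y = parent-of-neighbour (Adj-sym G xy) (λ px≡y → px∉ (here px≡y))
    py∉l : parent y ∉ l
    py∉l py∈l = Unique[x∷xs]⇒x∉xs xl! (there (subst (_∈ l) parent-y py∈l))

  parent-closed : ∀ l → Unique (root ∷ l) → Linked (Adj G) (root ∷ l) → ∀ {w} → w ∈ root ∷ l → parent w ∈ root ∷ l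
  parent-closed l l! l-path (here refl) = here parent-root
  parent-closed l l! l-path (there w∈l) =
    parents-along root l l! l-path (subst (_∉ l) (sym parent-root) (Unique[x∷xs]⇒x∉xs l!)) w∈l

  Child : Fin n → Fin n → Set
  Child u w = Adj G u w × parent w ≡ u

  root-not-child : ∀ {v} → ¬ Child v root
  root-not-child (v-root , parent-root≡v) =
    Adj-irrefl G (subst (λ u → Adj G u root) (trans (sym parent-root≡v) parent-root) v-root)

  child : ∀ {u w} → w ∈ nbrs G u → parent u ≢ w → Child u w
  child w∈ pu≢w = ∈-nbrs⁻ G w∈ , parent-of-neighbour (Adj-sym G (∈-nbrs⁻ G w∈)) pu≢w

  two-children : ∀ {u} → 3 ≤ deg G u →
    ∃[ w₁ ] ∃[ w₂ ] (w₁ ≢ w₂ × Child u w₁ × Child u w₂)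
  two-children {u} deg≥3 with three-distinct (nbrs G u) deg≥3 (nbrs-unique G u)
  ... | x , y , z , x∈ , y∈ , z∈ , x≢y , x≢z , y≢z with parent u ≟ x | parent u ≟ y
  ... | yes pu≡x | _        = y , z , y≢z , child y∈ (λ pu≡y → x≢y (trans (sym pu≡x) pu≡y))
                                          , child z∈ (λ pu≡z → x≢z (trans (sym pu≡x) pu≡z))
  ... | no pu≢x  | yes pu≡y = x , z , x≢z , child x∈ pu≢x , child z∈ (λ pu≡z → y≢z (trans (sym pu≡y) pu≡z))
  ... | no pu≢x  | no pu≢y  = x , y , x≢y , child x∈ pu≢x , child y∈ pu≢y

module SpineOrder {n : ℕ} (G : Graph n) (tree : IsTree G) (root : Fin n) (l : List (Fin n))
  (spine! : Unique (root ∷ l)) (spine-path : Linked (Adj G) (root ∷ l)) where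
  open RootedTree G tree root
  open DecMembership (_≟_ {n}) using (_∈?_)

  spine : List (Fin n)
  spine = root ∷ l

  open Fibres parent (λ w → ¬? (w ∈? spine))

  order : List (Fin n)
  order = evensThenOdds spine ++ fibres

  order-unique : Unique order
  order-unique = ++⁺ (evensThenOdds-unique spine spine!) fibres-unique
    λ (v∈spine , v∈fibres) → ∈-fibres⁻ v∈fibres (∈-evensThenOdds⁻ spine v∈spine)

  order-complete : ∀ v → v ∈ order
  order-complete v with v ∈? spine
  ... | yes v∈spine = ∈-++⁺ˡ (∈-evensThenOdds⁺ spine v∈spine)
  ... | no  v∉spine = ∈-++⁺ʳ (evensThenOdds spine) (∈-fibres⁺ v∉spine)

  child-off-spine : ∀ {v w} → v ∉ spine → Child v w → w ∉ spine
  child-off-spine v∉spine (_ , parent-w) w∈spine =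
    v∉spine (subst (_∈ spine) parent-w (parent-closed l spine! spine-path w∈spine))

  ConsecutiveNeighbours : Fin n → Set
  ConsecutiveNeighbours v = ∃[ x ] ∃[ y ] (Adj G v x × Adj G v y × Consecutive x y order)

  interior-consecutive : ∀ {v} → Interior v spine → ConsecutiveNeighbours v
  interior-consecutive (B , x , y , C , eq) =
    let xv , vy = linked-middle B C (subst (Linked (Adj G)) eq spine-path)
    in x , y , Adj-sym G xv , vy , subst (Consecutive x y) (cong (_++ fibres) (cong evensThenOdds (sym eq)))
                                          (consecutive-++ˡ _ fibres (consecutive-evensThenOdds B C))

  children-consecutive : ∀ {v} → 3 ≤ deg G v → (∀ {w} → Child v w → w ∉ spine) → ConsecutiveNeighbours v
  children-consecutive {v} deg≥3 off-spine with two-children deg≥3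
  ... | w₁ , w₂ , w₁≢w₂ , c₁ , c₂
    with consecutive-fibres w₁≢w₂ (off-spine c₁) (proj₂ c₁) (off-spine c₂) (proj₂ c₂)
  ... | x , y , xy , px , py , x∉ , y∉ =
    x , y , fibre-adjacent px x∉ , fibre-adjacent py y∉ , consecutive-++ʳ (evensThenOdds spine) fibres xy
    where
    fibre-adjacent : ∀ {w} → parent w ≡ v → w ∉ spine → Adj G v w
    fibre-adjacent refl w∉spine = Adj-sym G (parent-adjacent (λ { refl → w∉spine (here refl) }))

  SpineCondition : Fin n → Set
  SpineCondition v = Interior v spine ⊎ (3 ≤ deg G v × (∀ {w} → Child v w → w ∉ spine))

  neighbourhoodPrime : (∀ v → deg G v > 1 → SpineCondition v) → NeighborhoodPrime G
  neighbourhoodPrime shape = Enumeration.neighbourhoodPrime order order-unique order-complete G λ v deg>1 →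
    [ interior-consecutive , uncurry children-consecutive ]′ (shape v deg>1)

>1∧≢2⇒≥3 : ∀ {m} → m > 1 → m ≢ 2 → 3 ≤ m
>1∧≢2⇒≥3 m>1 m≢2 = ≤∧≢⇒< m>1 (λ 2≡m → m≢2 (sym 2≡m))

mainTheorem15 : {n : ℕ} (G : Graph n) →
    (IsBivalentFreeTree G
      ⊎ (IsTree G × ∃[ a ] ∃[ b ] ∃[ p ]
           (IsLeaf G a × IsLeaf G b × a ≢ b × IsPath G a b p
             × (∀ v → deg G v ≡ 2 → v ∈ p)))) →
    NeighborhoodPrime G
mainTheorem15 {zero} G _ = ⤖-id (Fin zero) , λ ()
mainTheorem15 {suc _} G (inj₁ (tree , no-deg-2)) =
  SpineOrder.neighbourhoodPrime G tree zero [] (∷-unique (λ ()) []) [-] λ v deg>1 →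
    inj₂ (>1∧≢2⇒≥3 deg>1 (no-deg-2 v) , λ { c (here refl) → RootedTree.root-not-child G tree zero c })
mainTheorem15 G (inj₂ (_ , _ , _ , [] , _ , _ , _ , (_ , _ , () , _) , _))
mainTheorem15 G (inj₂ (tree , a , b , a ∷ l , a-leaf , b-leaf , _ , (spine! , spine-path , refl , spine-last) , deg-2-on-spine)) =
  neighbourhoodPrime shape
  where
  open SpineOrder G tree a l spine! spine-path
  open DecMembership _≟_ using (_∈?_)
  shape : ∀ v → deg G v > 1 → SpineCondition v
  shape v deg>1 with v ∈? spine
  ... | yes (here refl) = ⊥-elim (<-irrefl (sym a-leaf) deg>1)
  ... | yes (there v∈l) = inj₁ (interior-of-∈ a l v∈l spine-last λ { refl → <-irrefl (sym b-leaf) deg>1 })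
  ... | no v∉spine      = inj₂ (>1∧≢2⇒≥3 deg>1 (λ deg≡2 → v∉spine (deg-2-on-spine v deg≡2)) , child-off-spine v∉spine)
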